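{- Let $B$ be a Chomp board, i.e. a finite set of cells $(x,y)$ with $x,y$ positive integers such that whenever $(x,y)\in B$, $1\le p\le x$ and $1\le q\le y$, also $(p,q)\in B$. Play random Chomp starting from $B$: on each turn the player to move selects a cell $(x,y)$ of the current board uniformly at random, independently of previous turns, and removes every cell $(p,q)$ with $p\ge x$ and $q\ge y$; the game ends when the board is empty. Then the expected number of turns is \[ \mathbb{E}[\text{number of turns starting from } B] = \sum_{(x,y)\in B}\frac{1}{xy}. \] In particular, if $B$ is the $m\times n$ rectangle $\{(x,y):1\le x\le m,\ 1\le y\le n\}$, the expected number of turns is $\left(\sum_{j=1}^m \frac1j\right)\left(\sum_{j=1}^n\frac1j\right)$.
   Context: A cell $(x,y)$ lies in row $x$ and column $y$, with $(1,1)$ the top-left cell. The game ends when the cell $(1,1)$ is chomped (the board then becomes empty). For the empty board the number of turns is $0$. -}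

module Defs where

open import Data.Nat using (ℕ; zero; suc; _*_; _≤_; _≤ᵇ_)
open import Data.Bool using (Bool; _∧_; not)
open import Data.Product using (_×_; _,_)
open import Data.List using (List; []; _∷_; length; filterᵇ; map; concatMap; upTo; foldr)
open import Data.List.Membership.Propositional using (_∈_)
open import Data.List.Relation.Unary.Unique.Propositional using (Unique)
open import Data.Integer using (+_)
open import Data.Rational using (ℚ; 0ℚ; 1ℚ; _+_; _/_) renaming (_*_ to _*ℚ_)

-- A cell (x , y): row x, column y (1-based).
Cell : Set
Cell = ℕ × ℕ

record IsChompBoard (B : List Cell) : Set where
  field
    unique    : Unique B
    positive  : ∀ {x y} → (x , y) ∈ B → 1 ≤ x × 1 ≤ y
    downClosed : ∀ {x y} p q → (x , y) ∈ B → 1 ≤ p → p ≤ x → 1 ≤ q → q ≤ y → (p , q) ∈ B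

chomp : Cell → List Cell → List Cell
chomp (x , y) = filterᵇ (λ { (p , q) → not ((x ≤ᵇ p) ∧ (y ≤ᵇ q)) })

sumℚ : List ℚ → ℚ
sumℚ = foldr _+_ 0ℚ

-- 1/n (with the junk value 0 at n = 0, never used on cells with positive coordinates)
recip : ℕ → ℚ
recip zero = 0ℚ
recip (suc n) = + 1 / suc n

-- Expected number of turns of random Chomp, by the defining first-step recursion:
-- E(∅) = 0,  E(B) = 1 + (1/|B|) Σ_{c ∈ B} E(chomp c B)   (each cell chosen with prob. 1/|B|).
-- The fuel argument only ensures structural recursion; it is set to |B|, and each chomp
-- of a cell of B removes at least that cell.
expectedTurnsFuel : ℕ → List Cell → ℚ
expectedTurnsFuel _ [] = 0ℚ
expectedTurnsFuel zero (_ ∷ _) = 0ℚ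
expectedTurnsFuel (suc f) (c ∷ cs) =
  1ℚ + ((+ 1 / suc (length cs)) *ℚ sumℚ (map (λ d → expectedTurnsFuel f (chomp d (c ∷ cs))) (c ∷ cs)))

expectedTurns : List Cell → ℚ
expectedTurns B = expectedTurnsFuel (length B) B

cellWeightSum : List Cell → ℚ
cellWeightSum B = sumℚ (map (λ { (x , y) → recip (x * y) }) B)

rectangle : ℕ → ℕ → List Cell
rectangle m n = concatMap (λ i → map (λ j → (suc i , suc j)) (upTo n)) (upTo m)

harmonic : ℕ → ℚ
harmonic m = sumℚ (map (λ j → recip (suc j)) (upTo m))

{-# OPTIONS --safe #-}
module Submission where

-- Write w (x , y) = 1/(xy) and W B = Σ_{c ∈ B} w c. It suffices that W satisfies the first-step
-- recursion defining the expected number of turns, i.e. Σ_{d ∈ B} W (chomp d B) = |B| W B − |B|.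
-- Exchanging the order of summation, the left side is Σ_{c ∈ B} w c · #{d ∈ B : d ⋠ c}. Since B is
-- down-closed and duplicate-free, the cells d ≼ c of B are exactly the x × y rectangle below
-- c = (x , y), so #{d ∈ B : d ⋠ c} = |B| − xy and the c-th summand is |B| w c − 1. On a rectangle,
-- W factorises into a product of harmonic numbers.

open import Defs
open import Data.Nat as ℕ using (ℕ; zero; suc; _≤_; _<_; s≤s; _≤ᵇ_; NonZero)
import Data.Nat.Properties as ℕ
open import Data.Nat.Tactic.RingSolver using (solve)
import Data.Integer as ℤ
open import Data.Rational using (ℚ; 0ℚ; 1ℚ; _+_; _*_; _/_; toℚᵘ)
open import Data.Rational.Properties
  using (toℚᵘ-injective; toℚᵘ-fromℚᵘ; toℚᵘ-homo-+; toℚᵘ-homo-*; +-0-commutativeMonoid;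
         +-assoc; +-comm; +-identityˡ; *-assoc; *-comm; *-identityˡ; *-identityʳ; *-zeroʳ; *-distribˡ-+)
open import Data.Rational.Unnormalised as ᵘ using (mkℚᵘ; *≡*) renaming (_≃_ to _≃ᵘ_)
import Data.Rational.Unnormalised.Properties as ᵘ
open import Data.Bool using (Bool; true; false; T; not; _∧_; if_then_else_)
open import Data.Bool.Properties using (T-∧; T?)
open import Data.Product using (_×_; _,_; proj₁)
open import Data.List using (List; []; _∷_; _++_; length; map; filterᵇ; concatMap; upTo; cartesianProductWith)
import Data.List.Properties as List
open import Data.List.Membership.Propositional using (_∈_)
open import Data.List.Membership.Propositional.Properties
  using (∈-filter⁺; ∈-filter⁻; ∈-cartesianProductWith⁺; ∈-cartesianProductWith⁻; ∈-upTo⁺; ∈-upTo⁻)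
open import Data.List.Membership.Propositional.Properties.WithK using (unique∧set⇒bag)
open import Data.List.Relation.Unary.Any using (here; there)
import Data.List.Relation.Unary.Any as Any
open import Data.List.Relation.Unary.Unique.Propositional using (Unique)
import Data.List.Relation.Unary.Unique.Propositional.Properties as Unique
open import Data.List.Relation.Binary.BagAndSetEquality using (∼bag⇒↭)
open import Data.List.Relation.Binary.Permutation.Propositional.Properties using (↭-length)
open import Algebra.Bundles using (CommutativeMonoid)
open import Function using (_∘_; _⇔_; mk⇔; Equivalence)
open import Relation.Nullary using (¬_)
open import Relation.Binary.PropositionalEquality using (_≡_; refl; sym; trans; cong; cong₂; subst; module ≡-Reasoning)

open import Algebra.Properties.CommutativeSemigroup (CommutativeMonoid.commutativeSemigroup +-0-commutativeMonoid)
  using (x∙yz≈y∙xz) renaming (interchange to +-interchange)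

private variable
  A C D : Set

∑ : List A → (A → ℚ) → ℚ
∑ xs f = sumℚ (map f xs)

syntax ∑ xs (λ x → e) = ∑[ x ← xs ] e

∑-cong : {xs : List A} {f g : A → ℚ} → (∀ {x} → x ∈ xs → f x ≡ g x) → ∑ xs f ≡ ∑ xs g
∑-cong {xs = []} eq = refl
∑-cong {xs = x ∷ xs} eq = cong₂ _+_ (eq (here refl)) (∑-cong (eq ∘ there))

∑-++ : (xs ys : List A) (f : A → ℚ) → ∑ (xs ++ ys) f ≡ ∑ xs f + ∑ ys f
∑-++ [] ys f = sym (+-identityˡ _)
∑-++ (x ∷ xs) ys f = trans (cong (f x +_) (∑-++ xs ys f)) (sym (+-assoc (f x) _ _))

∑-map : (g : A → C) (xs : List A) (f : C → ℚ) → ∑ (map g xs) f ≡ ∑[ x ← xs ] f (g x)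
∑-map g xs f = cong sumℚ (sym (List.map-∘ xs))

∑-concatMap : (g : A → List C) (xs : List A) (f : C → ℚ) → ∑ (concatMap g xs) f ≡ ∑[ x ← xs ] ∑ (g x) f
∑-concatMap g [] f = refl
∑-concatMap g (x ∷ xs) f = trans (∑-++ (g x) (concatMap g xs) f) (cong (∑ (g x) f +_) (∑-concatMap g xs f))

∑-+ : (xs : List A) (f g : A → ℚ) → ∑[ x ← xs ] (f x + g x) ≡ ∑ xs f + ∑ xs g
∑-+ [] f g = sym (+-identityˡ 0ℚ)
∑-+ (x ∷ xs) f g = trans (cong (f x + g x +_) (∑-+ xs f g)) (+-interchange (f x) (g x) _ _)

∑-*ˡ : (a : ℚ) (xs : List A) (f : A → ℚ) → ∑[ x ← xs ] (a * f x) ≡ a * ∑ xs f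
∑-*ˡ a [] f = sym (*-zeroʳ a)
∑-*ˡ a (x ∷ xs) f = trans (cong (a * f x +_) (∑-*ˡ a xs f)) (sym (*-distribˡ-+ a (f x) _))

∑-*ʳ : (a : ℚ) (xs : List A) (f : A → ℚ) → ∑[ x ← xs ] (f x * a) ≡ ∑ xs f * a
∑-*ʳ a xs f = trans (∑-cong {xs = xs} (λ {x} _ → *-comm (f x) a)) (trans (∑-*ˡ a xs f) (*-comm a _))

∑-zero : (xs : List A) → ∑[ _ ← xs ] 0ℚ ≡ 0ℚ
∑-zero [] = refl
∑-zero (x ∷ xs) = trans (+-identityˡ _) (∑-zero xs)

∑-comm : (xs : List A) (ys : List C) (h : A → C → ℚ) →
         ∑[ x ← xs ] ∑[ y ← ys ] h x y ≡ ∑[ y ← ys ] ∑[ x ← xs ] h x y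
∑-comm [] ys h = sym (∑-zero ys)
∑-comm (x ∷ xs) ys h =
  trans (cong (∑ ys (h x) +_) (∑-comm xs ys h)) (sym (∑-+ ys (h x) (λ y → ∑[ x′ ← xs ] h x′ y)))

∑-filterᵇ : (P : A → Bool) (xs : List A) (f : A → ℚ) →
            ∑ (filterᵇ P xs) f ≡ ∑[ x ← xs ] (if P x then f x else 0ℚ)
∑-filterᵇ P [] f = refl
∑-filterᵇ P (x ∷ xs) f with P x
... | true  = cong (f x +_) (∑-filterᵇ P xs f)
... | false = trans (∑-filterᵇ P xs f) (sym (+-identityˡ _))

∑-filterᵇ-not : (P : A → Bool) (xs : List A) (f : A → ℚ) →
                ∑ (filterᵇ (not ∘ P) xs) f + ∑ (filterᵇ P xs) f ≡ ∑ xs f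
∑-filterᵇ-not P [] f = refl
∑-filterᵇ-not P (x ∷ xs) f with P x
... | true  = trans (x∙yz≈y∙xz (∑ (filterᵇ (not ∘ P) xs) f) (f x) _) (cong (f x +_) (∑-filterᵇ-not P xs f))
... | false = trans (+-assoc (f x) _ _) (cong (f x +_) (∑-filterᵇ-not P xs f))

∑-comm-filterᵇ : (R : A → C → Bool) (xs : List A) (ys : List C) (f : A → C → ℚ) →
  ∑[ x ← xs ] ∑[ y ← filterᵇ (R x) ys ] f x y ≡ ∑[ y ← ys ] ∑[ x ← filterᵇ (λ x → R x y) xs ] f x y
∑-comm-filterᵇ R xs ys f = begin
  ∑[ x ← xs ] ∑[ y ← filterᵇ (R x) ys ] f x y
    ≡⟨ ∑-cong {xs = xs} (λ {x} _ → ∑-filterᵇ (R x) ys (f x)) ⟩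
  ∑[ x ← xs ] ∑[ y ← ys ] (if R x y then f x y else 0ℚ)
    ≡⟨ ∑-comm xs ys _ ⟩
  ∑[ y ← ys ] ∑[ x ← xs ] (if R x y then f x y else 0ℚ)
    ≡⟨ ∑-cong {xs = ys} (λ {y} _ → ∑-filterᵇ (λ x → R x y) xs (λ x → f x y)) ⟨
  ∑[ y ← ys ] ∑[ x ← filterᵇ (λ x → R x y) xs ] f x y ∎
  where open ≡-Reasoning

fromℕ : ℕ → ℚ
fromℕ k = ℤ.+ k / 1

toℚᵘ-/ : ∀ i n .{{_ : NonZero n}} → toℚᵘ (i / n) ≃ᵘ i ᵘ./ n
toℚᵘ-/ i (suc n) = toℚᵘ-fromℚᵘ (mkℚᵘ i n)

fromℕ-suc : ∀ k → fromℕ (suc k) ≡ 1ℚ + fromℕ k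
-- The split exposes the sign of the numerator, which unnormalised addition inspects.
fromℕ-suc zero = refl
fromℕ-suc (suc k) = toℚᵘ-injective (begin
  toℚᵘ (fromℕ (suc (suc k)))            ≈⟨ toℚᵘ-/ (ℤ.+ suc (suc k)) 1 ⟩
  ℤ.+ suc (suc k) ᵘ./ 1                 ≈⟨ *≡* (cong (λ n → ℤ.+ suc n) (solve (k ∷ []))) ⟩
  (ℤ.+ 1 ᵘ./ 1) ᵘ.+ (ℤ.+ suc k ᵘ./ 1)   ≈⟨ ᵘ.+-cong (toℚᵘ-/ (ℤ.+ 1) 1) (toℚᵘ-/ (ℤ.+ suc k) 1) ⟨
  toℚᵘ 1ℚ ᵘ.+ toℚᵘ (fromℕ (suc k))      ≈⟨ toℚᵘ-homo-+ 1ℚ (fromℕ (suc k)) ⟨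
  toℚᵘ (1ℚ + fromℕ (suc k))             ∎)
  where open ᵘ.≃-Reasoning

recip-*-fromℕ : ∀ n .{{_ : NonZero n}} → recip n * fromℕ n ≡ 1ℚ
recip-*-fromℕ (suc k) = toℚᵘ-injective (begin
  toℚᵘ (recip (suc k) * fromℕ (suc k))            ≈⟨ toℚᵘ-homo-* (recip (suc k)) (fromℕ (suc k)) ⟩
  toℚᵘ (recip (suc k)) ᵘ.* toℚᵘ (fromℕ (suc k))   ≈⟨ ᵘ.*-cong (toℚᵘ-/ (ℤ.+ 1) (suc k)) (toℚᵘ-/ (ℤ.+ suc k) 1) ⟩
  (ℤ.+ 1 ᵘ./ suc k) ᵘ.* (ℤ.+ suc k ᵘ./ 1)         ≈⟨ *≡* (cong (λ n → ℤ.+ suc n) (solve (k ∷ []))) ⟩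
  toℚᵘ 1ℚ                                         ∎)
  where open ᵘ.≃-Reasoning

recip-* : ∀ m n .{{_ : NonZero m}} .{{_ : NonZero n}} → recip (m ℕ.* n) ≡ recip m * recip n
recip-* (suc m) (suc n) = toℚᵘ-injective (begin
  toℚᵘ (recip (suc m ℕ.* suc n))              ≈⟨ toℚᵘ-/ (ℤ.+ 1) (suc m ℕ.* suc n) ⟩
  (ℤ.+ 1 ᵘ./ suc m) ᵘ.* (ℤ.+ 1 ᵘ./ suc n)     ≈⟨ ᵘ.*-cong (toℚᵘ-/ (ℤ.+ 1) (suc m)) (toℚᵘ-/ (ℤ.+ 1) (suc n)) ⟨
  toℚᵘ (recip (suc m)) ᵘ.* toℚᵘ (recip (suc n)) ≈⟨ toℚᵘ-homo-* (recip (suc m)) (recip (suc n)) ⟨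
  toℚᵘ (recip (suc m) * recip (suc n))        ∎)
  where open ᵘ.≃-Reasoning

∑-one : (xs : List A) → ∑[ _ ← xs ] 1ℚ ≡ fromℕ (length xs)
∑-one [] = refl
∑-one (x ∷ xs) = trans (cong (1ℚ +_) (∑-one xs)) (sym (fromℕ-suc (length xs)))

∑-const : (a : ℚ) (xs : List A) → ∑[ _ ← xs ] a ≡ a * fromℕ (length xs)
∑-const a xs = begin
  ∑[ _ ← xs ] a          ≡⟨ ∑-cong {xs = xs} (λ _ → *-identityʳ a) ⟨
  ∑[ _ ← xs ] (a * 1ℚ)   ≡⟨ ∑-*ˡ a xs (λ _ → 1ℚ) ⟩
  a * ∑[ _ ← xs ] 1ℚ     ≡⟨ cong (a *_) (∑-one xs) ⟩
  a * fromℕ (length xs)  ∎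
  where open ≡-Reasoning

first-step-solution : ∀ n .{{_ : NonZero n}} (s w : ℚ) →
                      s + fromℕ n ≡ fromℕ n * w → 1ℚ + recip n * s ≡ w
first-step-solution n s w eq = begin
  1ℚ + recip n * s                       ≡⟨ +-comm 1ℚ (recip n * s) ⟩
  recip n * s + 1ℚ                       ≡⟨ cong (recip n * s +_) (recip-*-fromℕ n) ⟨
  recip n * s + recip n * fromℕ n        ≡⟨ *-distribˡ-+ (recip n) s _ ⟨
  recip n * (s + fromℕ n)                ≡⟨ cong (recip n *_) eq ⟩
  recip n * (fromℕ n * w)                ≡⟨ *-assoc (recip n) (fromℕ n) w ⟨
  (recip n * fromℕ n) * w                ≡⟨ cong (_* w) (recip-*-fromℕ n) ⟩
  1ℚ * w                                 ≡⟨ *-identityˡ w ⟩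
  w                                      ∎
  where open ≡-Reasoning

unique∧set⇒length-≡ : {xs ys : List A} → Unique xs → Unique ys → (∀ {z} → z ∈ xs ⇔ z ∈ ys) →
                      length xs ≡ length ys
unique∧set⇒length-≡ xs! ys! xs≈ys = ↭-length (∼bag⇒↭ (unique∧set⇒bag xs! ys! xs≈ys))

concatMap-map≡cartesianProductWith : (f : A → C → D) (xs : List A) (ys : List C) →
  concatMap (λ x → map (f x) ys) xs ≡ cartesianProductWith f xs ys
concatMap-map≡cartesianProductWith f [] ys = refl
concatMap-map≡cartesianProductWith f (x ∷ xs) ys =
  cong (map (f x) ys ++_) (concatMap-map≡cartesianProductWith f xs ys)

length-cartesianProductWith : (f : A → C → D) (xs : List A) (ys : List C) →
  length (cartesianProductWith f xs ys) ≡ length xs ℕ.* length ys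
length-cartesianProductWith f [] ys = refl
length-cartesianProductWith f (x ∷ xs) ys = begin
  length (map (f x) ys ++ cartesianProductWith f xs ys)        ≡⟨ List.length-++ (map (f x) ys) ⟩
  length (map (f x) ys) ℕ.+ length (cartesianProductWith f xs ys)
    ≡⟨ cong₂ ℕ._+_ (List.length-map (f x) ys) (length-cartesianProductWith f xs ys) ⟩
  length ys ℕ.+ length xs ℕ.* length ys                        ∎
  where open ≡-Reasoning

T-not⇒¬T : ∀ {b} → T (not b) → ¬ T b
T-not⇒¬T {false} _ ()

¬T⇒T-not : ∀ {b} → ¬ T b → T (not b)
¬T⇒T-not {false} _ = _
¬T⇒T-not {true} ¬t = ¬t _

_≼_ : Cell → Cell → Set
(x , y) ≼ (p , q) = x ≤ p × y ≤ q

-- chomp d B is definitionally filterᵇ (λ c → not (d ≼ᵇ c)) B.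
_≼ᵇ_ : Cell → Cell → Bool
(x , y) ≼ᵇ (p , q) = (x ≤ᵇ p) ∧ (y ≤ᵇ q)

≼ᵇ⇒≼ : ∀ c d → T (c ≼ᵇ d) → c ≼ d
≼ᵇ⇒≼ (x , y) (p , q) t = let (x≤p , y≤q) = Equivalence.to T-∧ t in ℕ.≤ᵇ⇒≤ x p x≤p , ℕ.≤ᵇ⇒≤ y q y≤q

≼⇒≼ᵇ : ∀ {c d} → c ≼ d → T (c ≼ᵇ d)
≼⇒≼ᵇ (x≤p , y≤q) = Equivalence.from T-∧ (ℕ.≤⇒≤ᵇ x≤p , ℕ.≤⇒≤ᵇ y≤q)

≼-refl : ∀ {c} → c ≼ c
≼-refl = ℕ.≤-refl , ℕ.≤-refl

≼-trans : ∀ {c d e} → c ≼ d → d ≼ e → c ≼ e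
≼-trans (x≤p , y≤q) (p≤s , q≤t) = ℕ.≤-trans x≤p p≤s , ℕ.≤-trans y≤q q≤t

∈-chomp⁻ : ∀ d (B : List Cell) {e} → e ∈ chomp d B → e ∈ B × ¬ d ≼ e
∈-chomp⁻ d B e∈ = let (e∈B , kept) = ∈-filter⁻ (T? ∘ λ c → not (d ≼ᵇ c)) e∈ in
  e∈B , λ d≼e → T-not⇒¬T kept (≼⇒≼ᵇ d≼e)

∈-chomp⁺ : ∀ d (B : List Cell) {e} → e ∈ B → ¬ d ≼ e → e ∈ chomp d B
∈-chomp⁺ d B {e} e∈B d⋠e = ∈-filter⁺ (T? ∘ λ c → not (d ≼ᵇ c)) e∈B (¬T⇒T-not (d⋠e ∘ ≼ᵇ⇒≼ d e))

length-chomp-< : ∀ d (B : List Cell) → d ∈ B → length (chomp d B) < length B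
length-chomp-< d B d∈B = List.filter-notAll (T? ∘ λ c → not (d ≼ᵇ c)) B
  (Any.map (λ { refl kept → T-not⇒¬T kept (≼⇒≼ᵇ {d} ≼-refl) }) d∈B)

chomp-isChompBoard : ∀ d {B} → IsChompBoard B → IsChompBoard (chomp d B)
chomp-isChompBoard d {B} board = record
  { unique     = Unique.filter⁺ (T? ∘ λ c → not (d ≼ᵇ c)) (IsChompBoard.unique board)
  ; positive   = IsChompBoard.positive board ∘ proj₁ ∘ ∈-chomp⁻ d B
  ; downClosed = λ p q e∈ 1≤p p≤x 1≤q q≤y →
      let (e∈B , d⋠e) = ∈-chomp⁻ d B e∈ in
      ∈-chomp⁺ d B (IsChompBoard.downClosed board p q e∈B 1≤p p≤x 1≤q q≤y)
                   (λ d≼pq → d⋠e (≼-trans {d} d≼pq (p≤x , q≤y)))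
  }

fromIndices : ℕ → ℕ → Cell
fromIndices i j = (suc i , suc j)

rectangle≡cartesianProductWith : ∀ m n → rectangle m n ≡ cartesianProductWith fromIndices (upTo m) (upTo n)
rectangle≡cartesianProductWith m n = concatMap-map≡cartesianProductWith fromIndices (upTo m) (upTo n)

∈-rectangle⁺ : ∀ {m n p q} → 1 ≤ p → p ≤ m → 1 ≤ q → q ≤ n → (p , q) ∈ rectangle m n
∈-rectangle⁺ {m} {n} (s≤s _) p≤m (s≤s _) q≤n =
  subst ((_ , _) ∈_) (sym (rectangle≡cartesianProductWith m n))
        (∈-cartesianProductWith⁺ fromIndices (∈-upTo⁺ p≤m) (∈-upTo⁺ q≤n))

∈-rectangle⁻ : ∀ m n {p q} → (p , q) ∈ rectangle m n → (1 ≤ p × p ≤ m) × (1 ≤ q × q ≤ n)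
∈-rectangle⁻ m n pq∈ with ∈-cartesianProductWith⁻ fromIndices (upTo m) (upTo n)
                            (subst (_ ∈_) (rectangle≡cartesianProductWith m n) pq∈)
... | _ , _ , i∈ , j∈ , refl = (s≤s ℕ.z≤n , ∈-upTo⁻ i∈) , (s≤s ℕ.z≤n , ∈-upTo⁻ j∈)

rectangle-unique : ∀ m n → Unique (rectangle m n)
rectangle-unique m n = subst Unique (sym (rectangle≡cartesianProductWith m n))
  (Unique.cartesianProductWith⁺ fromIndices (λ { refl → refl , refl }) (Unique.upTo⁺ m) (Unique.upTo⁺ n))

length-rectangle : ∀ m n → length (rectangle m n) ≡ m ℕ.* n
length-rectangle m n = begin
  length (rectangle m n)
    ≡⟨ cong length (rectangle≡cartesianProductWith m n) ⟩
  length (cartesianProductWith fromIndices (upTo m) (upTo n))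
    ≡⟨ length-cartesianProductWith fromIndices (upTo m) (upTo n) ⟩
  length (upTo m) ℕ.* length (upTo n)
    ≡⟨ cong₂ ℕ._*_ (List.length-upTo m) (List.length-upTo n) ⟩
  m ℕ.* n ∎
  where open ≡-Reasoning

rectangle-isChompBoard : ∀ m n → IsChompBoard (rectangle m n)
rectangle-isChompBoard m n = record
  { unique     = rectangle-unique m n
  ; positive   = λ xy∈ → let ((1≤x , _) , (1≤y , _)) = ∈-rectangle⁻ m n xy∈ in 1≤x , 1≤y
  ; downClosed = λ p q xy∈ 1≤p p≤x 1≤q q≤y →
      let ((_ , x≤m) , (_ , y≤n)) = ∈-rectangle⁻ m n xy∈ in
      ∈-rectangle⁺ 1≤p (ℕ.≤-trans p≤x x≤m) 1≤q (ℕ.≤-trans q≤y y≤n)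
  }

lowerSet : Cell → List Cell → List Cell
lowerSet c B = filterᵇ (_≼ᵇ c) B

∈-lowerSet⇔∈-rectangle : ∀ {B x y e} → IsChompBoard B → (x , y) ∈ B →
                          e ∈ lowerSet (x , y) B ⇔ e ∈ rectangle x y
∈-lowerSet⇔∈-rectangle {B} {x} {y} {p , q} board xy∈B = mk⇔ to from
  where
  to : (p , q) ∈ lowerSet (x , y) B → (p , q) ∈ rectangle x y
  to pq∈ = let (pq∈B , pq≼xy) = ∈-filter⁻ (T? ∘ (_≼ᵇ (x , y))) pq∈
               (1≤p , 1≤q) = IsChompBoard.positive board pq∈B
               (p≤x , q≤y) = ≼ᵇ⇒≼ (p , q) (x , y) pq≼xy in
           ∈-rectangle⁺ 1≤p p≤x 1≤q q≤y
  from : (p , q) ∈ rectangle x y → (p , q) ∈ lowerSet (x , y) B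
  from pq∈ = let ((1≤p , p≤x) , (1≤q , q≤y)) = ∈-rectangle⁻ x y pq∈ in
             ∈-filter⁺ (T? ∘ (_≼ᵇ (x , y))) (IsChompBoard.downClosed board p q xy∈B 1≤p p≤x 1≤q q≤y)
                       (≼⇒≼ᵇ (p≤x , q≤y))

length-lowerSet : ∀ {B x y} → IsChompBoard B → (x , y) ∈ B → length (lowerSet (x , y) B) ≡ x ℕ.* y
length-lowerSet {B} {x} {y} board xy∈B = trans
  (unique∧set⇒length-≡ (Unique.filter⁺ (T? ∘ (_≼ᵇ (x , y))) (IsChompBoard.unique board))
                       (rectangle-unique x y) (∈-lowerSet⇔∈-rectangle board xy∈B))
  (length-rectangle x y)

weight : Cell → ℚ
weight (x , y) = recip (x ℕ.* y)

∑-weight-lowerSet : ∀ {B c} → IsChompBoard B → c ∈ B → ∑[ _ ← lowerSet c B ] weight c ≡ 1ℚ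
∑-weight-lowerSet {B} {x , y} board xy∈B = begin
  ∑[ _ ← lowerSet (x , y) B ] weight (x , y)
    ≡⟨ ∑-const (weight (x , y)) (lowerSet (x , y) B) ⟩
  recip (x ℕ.* y) * fromℕ (length (lowerSet (x , y) B))
    ≡⟨ cong (λ k → recip (x ℕ.* y) * fromℕ k) (length-lowerSet board xy∈B) ⟩
  recip (x ℕ.* y) * fromℕ (x ℕ.* y)
    ≡⟨ recip-*-fromℕ (x ℕ.* y) {{xy≢0}} ⟩
  1ℚ ∎
  where
  open ≡-Reasoning
  xy≢0 : NonZero (x ℕ.* y)
  xy≢0 = let (1≤x , 1≤y) = IsChompBoard.positive board xy∈B in
         ℕ.m*n≢0 x y {{ℕ.>-nonZero 1≤x}} {{ℕ.>-nonZero 1≤y}}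

∑-cellWeightSum-chomp : ∀ {B} → IsChompBoard B →
  ∑[ d ← B ] cellWeightSum (chomp d B) + fromℕ (length B) ≡ fromℕ (length B) * cellWeightSum B
∑-cellWeightSum-chomp {B} board = begin
  ∑[ d ← B ] ∑[ c ← chomp d B ] weight c + fromℕ n
    ≡⟨ cong₂ _+_ (∑-comm-filterᵇ (λ d c → not (d ≼ᵇ c)) B B (λ _ → weight)) (sym (∑-one B)) ⟩
  ∑[ c ← B ] ∑[ _ ← filterᵇ (not ∘ (_≼ᵇ c)) B ] weight c + ∑[ _ ← B ] 1ℚ
    ≡⟨ ∑-+ B _ _ ⟨
  ∑[ c ← B ] (∑[ _ ← filterᵇ (not ∘ (_≼ᵇ c)) B ] weight c + 1ℚ)
    ≡⟨ ∑-cong complement ⟩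
  ∑[ c ← B ] (fromℕ n * weight c)
    ≡⟨ ∑-*ˡ (fromℕ n) B weight ⟩
  fromℕ n * cellWeightSum B ∎
  where
  open ≡-Reasoning
  n = length B
  complement : ∀ {c} → c ∈ B → ∑[ _ ← filterᵇ (not ∘ (_≼ᵇ c)) B ] weight c + 1ℚ ≡ fromℕ n * weight c
  complement {c} c∈B = begin
    ∑[ _ ← filterᵇ (not ∘ (_≼ᵇ c)) B ] weight c + 1ℚ
      ≡⟨ cong (∑[ _ ← filterᵇ (not ∘ (_≼ᵇ c)) B ] weight c +_) (∑-weight-lowerSet board c∈B) ⟨
    ∑[ _ ← filterᵇ (not ∘ (_≼ᵇ c)) B ] weight c + ∑[ _ ← filterᵇ (_≼ᵇ c) B ] weight c
      ≡⟨ ∑-filterᵇ-not (_≼ᵇ c) B (λ _ → weight c) ⟩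
    ∑[ _ ← B ] weight c       ≡⟨ ∑-const (weight c) B ⟩
    weight c * fromℕ n        ≡⟨ *-comm (weight c) (fromℕ n) ⟩
    fromℕ n * weight c        ∎

cellWeightSum-firstStep : ∀ {B} → IsChompBoard B → .{{_ : NonZero (length B)}} →
  1ℚ + recip (length B) * ∑[ d ← B ] cellWeightSum (chomp d B) ≡ cellWeightSum B
cellWeightSum-firstStep {B} board =
  first-step-solution (length B) _ (cellWeightSum B) (∑-cellWeightSum-chomp board)

expectedTurnsFuel≡cellWeightSum : ∀ f B → IsChompBoard B → length B ≤ f →
                                  expectedTurnsFuel f B ≡ cellWeightSum B
expectedTurnsFuel≡cellWeightSum _ [] _ _ = refl
expectedTurnsFuel≡cellWeightSum (suc f) B@(_ ∷ _) board (s≤s |B|≤1+f) = begin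
  1ℚ + recip (length B) * ∑[ d ← B ] expectedTurnsFuel f (chomp d B)
    ≡⟨ cong (λ s → 1ℚ + recip (length B) * s) (∑-cong chomped) ⟩
  1ℚ + recip (length B) * ∑[ d ← B ] cellWeightSum (chomp d B)
    ≡⟨ cellWeightSum-firstStep board ⟩
  cellWeightSum B ∎
  where
  open ≡-Reasoning
  chomped : ∀ {d} → d ∈ B → expectedTurnsFuel f (chomp d B) ≡ cellWeightSum (chomp d B)
  chomped {d} d∈B = expectedTurnsFuel≡cellWeightSum f (chomp d B) (chomp-isChompBoard d board)
    (ℕ.≤-pred (ℕ.≤-trans (length-chomp-< d B d∈B) (s≤s |B|≤1+f)))

expectedTurns≡cellWeightSum : (B : List Cell) → IsChompBoard B → expectedTurns B ≡ cellWeightSum B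
expectedTurns≡cellWeightSum B board = expectedTurnsFuel≡cellWeightSum (length B) B board ℕ.≤-refl

cellWeightSum-rectangle : ∀ m n → cellWeightSum (rectangle m n) ≡ harmonic m * harmonic n
cellWeightSum-rectangle m n = begin
  ∑ (concatMap (λ i → map (fromIndices i) (upTo n)) (upTo m)) weight
    ≡⟨ ∑-concatMap (λ i → map (fromIndices i) (upTo n)) (upTo m) weight ⟩
  ∑[ i ← upTo m ] ∑ (map (fromIndices i) (upTo n)) weight
    ≡⟨ ∑-cong {xs = upTo m} (λ {i} _ → ∑-map (fromIndices i) (upTo n) weight) ⟩
  ∑[ i ← upTo m ] ∑[ j ← upTo n ] recip (suc i ℕ.* suc j)
    ≡⟨ ∑-cong {xs = upTo m} (λ {i} _ → ∑-cong {xs = upTo n} (λ {j} _ → recip-* (suc i) (suc j))) ⟩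
  ∑[ i ← upTo m ] ∑[ j ← upTo n ] (recip (suc i) * recip (suc j))
    ≡⟨ ∑-cong {xs = upTo m} (λ {i} _ → ∑-*ˡ (recip (suc i)) (upTo n) (recip ∘ suc)) ⟩
  ∑[ i ← upTo m ] (recip (suc i) * harmonic n)
    ≡⟨ ∑-*ʳ (harmonic n) (upTo m) (recip ∘ suc) ⟩
  harmonic m * harmonic n ∎
  where open ≡-Reasoning

theorem1 : ((B : List Cell) → IsChompBoard B → expectedTurns B ≡ cellWeightSum B)
    × ((m n : ℕ) → expectedTurns (rectangle m n) ≡ harmonic m * harmonic n)
theorem1 = expectedTurns≡cellWeightSum , λ m n →
  trans (expectedTurns≡cellWeightSum (rectangle m n) (rectangle-isChompBoard m n)) (cellWeightSum-rectangle m n)
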